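{- (1) The relation $\leadsto_{loop}$ on atoms is reflexive and transitive. (2) For atoms $A_1,A_2$, if $A_1\leadsto_{loop}A_2$ then $|A_1|\le|A_2|$. (3) For goals $G_1,G_2,G_3$ (labelling nodes of a generalized SLDNF-derivation), if $G_3$ is a loop goal of $G_2$ and $G_2$ is a loop goal of $G_1$, then $G_3$ is a loop goal of $G_1$.
   Context: Terms are constants, variables, or $f(T_1,\dots,T_m)$; atoms are $p(T_1,\dots,T_m)$. In lists $[\,]$ and $[T|L]$ the symbols $[$, $]$, $|$ are treated as function symbols. The size $|A|$ of an atom/term $A$ is the number of occurrences of function symbols, variables and constants in $A$. The symbol string $S_T$ of a term or atom $T$ is the string of all predicate symbols, function symbols, constants and variables of $T$ read left to right, with every variable replaced by a single symbol $\mathcal{X}$. For symbol strings, $S_1\subseteq_{proj}S_2$ means $S_1$ is obtained from $S_2$ by removing zero or more elements. For atoms $A_1=p(\ldots)$ and $A_2=p(\ldots)$ with the same predicate symbol $p$, $A_1\leadsto_{loop}A_2$ ($A_1$ loops into $A_2$) means $S_{A_1}\subseteq_{proj}S_{A_2}$. Generalized SLDNF-derivations: for a general logic program $P$ and a top goal $G_0=\leftarrow A_0$ ($A_0$ an atom), with the depth-first, left-most strategy (leftmost literal selected, clauses in textual order), the generalized SLDNF-tree consists of the SLDNF$^*$-tree rooted at $N_0:G_0$ with empty ancestor list $AL_{A_0@N_0}=\emptyset$ together with all its (recursively) subsidiary SLDNF$^*$-trees, each node with a ground negative selected literal $\neg A$ being linked by a dotted edge to the root $\leftarrow A$ of its subsidiary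 tree. In SLDNF$^*$-trees every literal $L$ at node $M$ carries an ancestor list $AL_{L@M}$: when a node $N_i$ with selected positive literal $L_1$ is resolved with a clause $B\leftarrow B_1,\dots,B_n$ (mgu $\theta$), each new literal $B_k\theta$ at the child gets ancestor list $\{(N_i,L_1)\}\cup AL_{L_1@N_i}$ while the remaining literals keep their lists; the root $\leftarrow A$ of a subsidiary tree for a negative literal $L_1=\neg A$ at $N_i$ gets $AL_{A@N_{i+1}}=AL_{L_1@N_i}$. A generalized SLDNF-derivation is a path of the generalized SLDNF-tree from $N_0$ along tree edges and dotted edges. For a node $N_i:G_i$, $L_i^1$ denotes the selected (leftmost) subgoal of $G_i$; $L_i^1\prec_{anc}L_j^1$ ($L_i^1$ is an ancestor subgoal of $L_j^1$) means $(N_i,L_i^1)\in AL_{L_j^1@N_j}$. If $N_i:G_i$ and $N_j:G_j$ are nodes in a generalized SLDNF-derivation with $L_i^1\prec_{anc}L_j^1$ and $L_i^1\leadsto_{loop}L_j^1$, then $G_j$ is called a loop goal of $G_i$. -}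

module Defs where

open import Data.Nat using (ℕ; zero; suc; _+_; _≤_; _<_)
open import Data.Vec using (Vec; []; _∷_)
open import Data.List using (List; []; _∷_; _++_; map)
open import Data.List.Membership.Propositional using (_∈_; _∉_)
open import Data.List.Relation.Binary.Sublist.Propositional using (_⊆_)
open import Data.Product using (Σ; _×_; _,_; ∃-syntax)
open import Relation.Binary.PropositionalEquality using (_≡_)
open import Function.Definitions using (Injective)

-- A first-order signature: predicate symbols, function symbols (including
-- the list symbols [ ] and [_|_]), constants and variables, with arities.
record Signature : Set₁ where
  field
    Pred     : Set
    Fun      : Set
    Const    : Set
    Var      : Set
    predAr   : Pred → ℕ
    funAr    : Fun → ℕ

module Logic (S : Signature) where
  open Signature S

  data Term : Set where
    var : Var → Term
    con : Const → Term
    app : (f : Fun) → Vec Term (funAr f) → Term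

  data Atom : Set where
    atom : (p : Pred) → Vec Term (predAr p) → Atom

  predOf : Atom → Pred
  predOf (atom p _) = p

  -- Symbols occurring in a symbol string; every variable becomes 𝒳
  data Symbol : Set where
    pS : Pred → Symbol
    fS : Fun → Symbol
    cS : Const → Symbol
    𝒳  : Symbol

  mutual
    symT : Term → List Symbol
    symT (var x)    = 𝒳 ∷ []
    symT (con c)    = cS c ∷ []
    symT (app f ts) = fS f ∷ symTs ts

    symTs : ∀ {n} → Vec Term n → List Symbol
    symTs []       = []
    symTs (t ∷ ts) = symT t ++ symTs ts

  symA : Atom → List Symbol
  symA (atom p ts) = pS p ∷ symTs ts

  mutual
    sizeT : Term → ℕ
    sizeT (var x)    = 1
    sizeT (con c)    = 1
    sizeT (app f ts) = suc (sizeTs ts)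

    sizeTs : ∀ {n} → Vec Term n → ℕ
    sizeTs []       = 0
    sizeTs (t ∷ ts) = sizeT t + sizeTs ts

  sizeA : Atom → ℕ
  sizeA (atom p ts) = sizeTs ts

  _⊆proj_ : List Symbol → List Symbol → Set
  S₁ ⊆proj S₂ = S₁ ⊆ S₂

  _⇝loop_ : Atom → Atom → Set
  A₁ ⇝loop A₂ = (predOf A₁ ≡ predOf A₂) × (symA A₁ ⊆proj symA A₂)

  mutual
    varsT : Term → List Var
    varsT (var x)    = x ∷ []
    varsT (con c)    = []
    varsT (app f ts) = varsTs ts

    varsTs : ∀ {n} → Vec Term n → List Var
    varsTs []       = []
    varsTs (t ∷ ts) = varsT t ++ varsTs ts

  varsA : Atom → List Var
  varsA (atom p ts) = varsTs ts

  Ground : Atom → Set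
  Ground A = varsA A ≡ []

  Subst : Set
  Subst = Var → Term

  mutual
    substT : Subst → Term → Term
    substT θ (var x)    = θ x
    substT θ (con c)    = con c
    substT θ (app f ts) = app f (substTs θ ts)

    substTs : ∀ {n} → Subst → Vec Term n → Vec Term n
    substTs θ []       = []
    substTs θ (t ∷ ts) = substT θ t ∷ substTs θ ts

  substA : Subst → Atom → Atom
  substA θ (atom p ts) = atom p (substTs θ ts)

  Unifier : Subst → Atom → Atom → Set
  Unifier θ A B = substA θ A ≡ substA θ B

  MGU : Subst → Atom → Atom → Set
  MGU θ A B = Unifier θ A B ×
              (∀ σ → Unifier σ A B → ∃[ δ ] (∀ x → σ x ≡ substT δ (θ x)))

  data Literal : Set where
    pos : Atom → Literal
    neg : Atom → Literal

  substL : Subst → Literal → Literal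
  substL θ (pos A) = pos (substA θ A)
  substL θ (neg A) = neg (substA θ A)

  varsL : Literal → List Var
  varsL (pos A) = varsA A
  varsL (neg A) = varsA A

  record Clause : Set where
    constructor _⟵_
    field
      head : Atom
      body : List Literal

  Program : Set
  Program = List Clause  -- textual order

  renameVar : (Var → Var) → Subst
  renameVar ρ x = var (ρ x)

  renameC : (Var → Var) → Clause → Clause
  renameC ρ (H ⟵ Bs) = substA (renameVar ρ) H ⟵ map (substL (renameVar ρ)) Bs

  varsC : Clause → List Var
  varsC (H ⟵ Bs) = varsA H ++ concatVars Bs
    where
      concatVars : List Literal → List Var
      concatVars []       = []
      concatVars (L ∷ Ls) = varsL L ++ concatVars Ls

  -- Nodes of a derivation are identified by their position i (node N_i).
  -- An ancestor list is a list of pairs (N_i , L_i^1).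
  AncList : Set
  AncList = List (ℕ × Atom)

  -- A goal: literals, each carrying its ancestor list AL_{L@N}
  Goal : Set
  Goal = List (Literal × AncList)

  varsG : Goal → List Var
  varsG []             = []
  varsG ((L , _) ∷ G)  = varsL L ++ varsG G

  -- one edge (tree edge or dotted edge) from node N_i : hist i
  -- to node N_{i+1}, leftmost selection rule
  data Step (P : Program) (i : ℕ) (hist : ℕ → Goal) : Goal → Goal → Set where
    -- resolution of the selected positive literal with a (renamed apart)
    -- variant of a program clause, θ an mgu
    resolve : ∀ {A al rest} (c : Clause) → c ∈ P →
              (ρ : Var → Var) → Injective _≡_ _≡_ ρ →
              (∀ x → x ∈ varsC (renameC ρ c) → ∀ m → m ≤ i → x ∉ varsG (hist m)) →
              (θ : Subst) → MGU θ A (Clause.head (renameC ρ c)) →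
              Step P i hist ((pos A , al) ∷ rest)
                (map (λ B → (substL θ B , ((i , A) ∷ al))) (Clause.body (renameC ρ c))
                 ++ map (λ { (L , al′) → (substL θ L , al′) }) rest)
    -- dotted edge to the root ← A of the subsidiary tree for ground ¬A
    negRoot : ∀ {A al rest} → Ground A →
              Step P i hist ((neg A , al) ∷ rest) ((pos A , al) ∷ [])
    -- tree edge past a ground negative literal
    negPass : ∀ {A al rest} → Ground A →
              Step P i hist ((neg A , al) ∷ rest) rest

  record Derivation (P : Program) (A₀ : Atom) : Set where
    field
      len   : ℕ
      goal  : ℕ → Goal
      start : goal 0 ≡ (pos A₀ , []) ∷ []
      step  : ∀ i → i < len → Step P i goal (goal i) (goal (suc i))

  -- G_j is a loop goal of G_i in the derivation D:
  -- L_i^1 ≺anc L_j^1 and L_i^1 ⇝loop L_j^1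
  LoopGoal : ∀ {P A₀} → Derivation P A₀ → ℕ → ℕ → Set
  LoopGoal D i j =
    i ≤ Derivation.len D × j ≤ Derivation.len D ×
    Σ Atom λ Ai → Σ Atom λ Aj → Σ AncList λ ali → Σ AncList λ alj →
    Σ Goal λ resti → Σ Goal λ restj →
      (Derivation.goal D i ≡ (pos Ai , ali) ∷ resti) ×
      (Derivation.goal D j ≡ (pos Aj , alj) ∷ restj) ×
      ((i , Ai) ∈ alj) ×
      (Ai ⇝loop Aj)

{-# OPTIONS --safe #-}
module Submission where

-- On atoms with the same predicate symbol, ⇝loop is the sublist order on symbol
-- strings, and |A| is the length of S_A minus one; this gives (1) and (2).  For
-- (3) the point is that ≺anc is transitive: whenever (N_j, A) occurs in the
-- ancestor list of a literal, the ancestor list of the subgoal A selected at N_j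
-- is contained in it.  Resolution builds the new lists as
-- (N_i, L_i^1) ∷ AL_{L_i^1@N_i}, so this invariant survives every step of a
-- derivation.

open import Defs
open import Data.Nat using (ℕ; zero; suc; _+_; _≤_; s≤s⁻¹)
open import Data.Nat.Properties using (<⇒≤)
open import Data.Product using (Σ; _×_; _,_)
open import Data.Sum using (inj₁; inj₂)
open import Data.List using (_∷_; _++_; length; map)
open import Data.List.Properties using (length-++)
open import Data.List.Relation.Unary.Any using (here; there)
open import Data.List.Membership.Propositional using (_∈_)
open import Data.List.Membership.Propositional.Properties using (∈-++⁻; ∈-map⁻)
open import Data.List.Relation.Binary.Subset.Propositional using (_⊆_)
import Data.List.Relation.Binary.Sublist.Propositional as Sublist
open import Data.List.Relation.Binary.Sublist.Heterogeneous.Properties using (length-mono-≤)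
open import Data.Vec using (Vec; []; _∷_)
open import Relation.Binary.PropositionalEquality using (_≡_; refl; sym; trans; cong; cong₂; subst; subst₂; module ≡-Reasoning)

module LoopProperties (S : Signature) where
  open Logic S

  mutual
    sizeT≡length-symT : (t : Term) → sizeT t ≡ length (symT t)
    sizeT≡length-symT (var x)    = refl
    sizeT≡length-symT (con c)    = refl
    sizeT≡length-symT (app f ts) = cong suc (sizeTs≡length-symTs ts)

    sizeTs≡length-symTs : ∀ {n} (ts : Vec Term n) → sizeTs ts ≡ length (symTs ts)
    sizeTs≡length-symTs []       = refl
    sizeTs≡length-symTs (t ∷ ts) = begin
      sizeT t + sizeTs ts                   ≡⟨ cong₂ _+_ (sizeT≡length-symT t) (sizeTs≡length-symTs ts) ⟩
      length (symT t) + length (symTs ts)   ≡⟨ sym (length-++ (symT t)) ⟩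
      length (symT t ++ symTs ts)           ∎
      where open ≡-Reasoning

  length-symA : (A : Atom) → length (symA A) ≡ suc (sizeA A)
  length-symA (atom p ts) = cong suc (sym (sizeTs≡length-symTs ts))

  ⇝loop-refl : (A : Atom) → A ⇝loop A
  ⇝loop-refl A = refl , Sublist.⊆-refl

  ⇝loop-trans : (A₁ A₂ A₃ : Atom) → A₁ ⇝loop A₂ → A₂ ⇝loop A₃ → A₁ ⇝loop A₃
  ⇝loop-trans _ _ _ (p₁≡p₂ , S₁⊆S₂) (p₂≡p₃ , S₂⊆S₃) = trans p₁≡p₂ p₂≡p₃ , Sublist.⊆-trans S₁⊆S₂ S₂⊆S₃

  ⇝loop⇒sizeA≤ : (A₁ A₂ : Atom) → A₁ ⇝loop A₂ → sizeA A₁ ≤ sizeA A₂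
  ⇝loop⇒sizeA≤ A₁ A₂ (_ , S₁⊆S₂) =
    s≤s⁻¹ (subst₂ _≤_ (length-symA A₁) (length-symA A₂) (length-mono-≤ S₁⊆S₂))

  record Selected (goal : ℕ → Goal) (j : ℕ) (A : Atom) (al : AncList) : Set where
    constructor selected
    field
      rest   : Goal
      goal≡  : goal j ≡ (pos A , al) ∷ rest

  Selected⇒∈ : ∀ {goal j A al} → Selected goal j A al → (pos A , al) ∈ goal j
  Selected⇒∈ {A = A} {al} (selected _ eq) = subst ((pos A , al) ∈_) (sym eq) (here refl)

  Selected-unique : ∀ {goal j A A′ al al′} →
    Selected goal j A al → Selected goal j A′ al′ → A ≡ A′ × al ≡ al′
  Selected-unique (selected _ eq) (selected _ eq′) with trans (sym eq) eq′
  ... | refl = refl , refl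

  ClosedAncestors : (ℕ → Goal) → AncList → Set
  ClosedAncestors goal al =
    ∀ {j A} → (j , A) ∈ al → Σ AncList λ alj → Selected goal j A alj × alj ⊆ al

  ClosedGoal : (ℕ → Goal) → Goal → Set
  ClosedGoal goal G = ∀ {L al} → (L , al) ∈ G → ClosedAncestors goal al

  ClosedAncestors-∷ : ∀ {goal i A al} →
    ClosedAncestors goal al → Selected goal i A al → ClosedAncestors goal ((i , A) ∷ al)
  ClosedAncestors-∷ {al = al} closed sel (here refl) = al , sel , there
  ClosedAncestors-∷ closed sel (there j∈al) with closed j∈al
  ... | alj , selⱼ , alj⊆al = alj , selⱼ , λ x∈alj → there (alj⊆al x∈alj)

  Step-preserves-ClosedGoal : ∀ {P i goal G G′} →
    Step P i goal G G′ → goal i ≡ G → ClosedGoal goal G → ClosedGoal goal G′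
  Step-preserves-ClosedGoal {i = i} (resolve {A} {al} {rest} c _ ρ _ _ θ _) goal-i closed L,al∈G′
    with ∈-++⁻ (map (λ B → substL θ B , (i , A) ∷ al) (Clause.body (renameC ρ c))) L,al∈G′
  ... | inj₁ ∈body with ∈-map⁻ _ ∈body
  ...   | _ , _ , refl = ClosedAncestors-∷ (closed (here refl)) (selected rest goal-i)
  Step-preserves-ClosedGoal (resolve _ _ _ _ _ _ _) goal-i closed L,al∈G′
      | inj₂ ∈rest with ∈-map⁻ _ ∈rest
  ...   | _ , L′,al∈rest , refl = closed (there L′,al∈rest)
  Step-preserves-ClosedGoal (negRoot _) _ closed (here refl)  = closed (here refl)
  Step-preserves-ClosedGoal (negPass _) _ closed L,al∈rest    = closed (there L,al∈rest)

  module _ {P A₀} (D : Derivation P A₀) where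
    open Derivation D

    Derivation-ClosedGoal : ∀ m → m ≤ len → ClosedGoal goal (goal m)
    Derivation-ClosedGoal zero    _     = subst (ClosedGoal goal) (sym start) λ { (here refl) () }
    Derivation-ClosedGoal (suc m) m<len =
      Step-preserves-ClosedGoal (step m m<len) refl (Derivation-ClosedGoal m (<⇒≤ m<len))

    ≺anc-trans : ∀ {i j k Ai Aj Ak alj alk} → k ≤ len →
      (i , Ai) ∈ alj → Selected goal j Aj alj →
      (j , Aj) ∈ alk → Selected goal k Ak alk → (i , Ai) ∈ alk
    ≺anc-trans {k = k} k≤len i∈alj selⱼ j∈alk selₖ
      with Derivation-ClosedGoal k k≤len (Selected⇒∈ selₖ) j∈alk
    ... | alj′ , selⱼ′ , alj′⊆alk with Selected-unique selⱼ selⱼ′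
    ...   | _ , refl = alj′⊆alk i∈alj

  LoopGoal-trans : (P : Program) (A₀ : Atom) (D : Derivation P A₀) (i j k : ℕ) →
    LoopGoal D j k → LoopGoal D i j → LoopGoal D i k
  LoopGoal-trans P A₀ D i j k
    (_ , k≤len , Aj , Ak , alj , alk , rj , rk , ej , ek , j∈alk , Aj⇝Ak)
    (i≤len , _ , Ai , Aj′ , ali , alj′ , ri , rj′ , ei , ej′ , i∈alj′ , Ai⇝Aj′)
    with Selected-unique {Derivation.goal D} (selected rj ej) (selected rj′ ej′)
  ... | refl , refl =
    i≤len , k≤len , Ai , Ak , ali , alk , ri , rk , ei , ek ,
    ≺anc-trans D k≤len i∈alj′ (selected rj ej) j∈alk (selected rk ek) ,
    ⇝loop-trans Ai Aj Ak Ai⇝Aj′ Aj⇝Ak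

theorem3p4 : (S : Signature) → let open Logic S in
    ((A : Atom) → A ⇝loop A) ×
    ((A₁ A₂ A₃ : Atom) → A₁ ⇝loop A₂ → A₂ ⇝loop A₃ → A₁ ⇝loop A₃) ×
    ((A₁ A₂ : Atom) → A₁ ⇝loop A₂ → sizeA A₁ ≤ sizeA A₂) ×
    ((P : Program) (A₀ : Atom) (D : Derivation P A₀) (i j k : ℕ) →
      LoopGoal D j k → LoopGoal D i j → LoopGoal D i k)
theorem3p4 S = ⇝loop-refl , ⇝loop-trans , ⇝loop⇒sizeA≤ , LoopGoal-trans
  where open LoopProperties S
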